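{- Let $N$ be a positive integer and $p$ a prime with $p \nmid N$. Let $T(p) \coloneqq \Gamma_0(N) \begin{pmatrix} 1 & 0 \\ 0 & p\end{pmatrix} \Gamma_0(N)$, and define $H_p(N) = \{\beta_\infty\} \cup \{\beta_j : 0 \le j < p\}$, where $\beta_\infty = \begin{pmatrix} p & 0 \\ 0 & 1\end{pmatrix}$ and $\beta_j = \begin{pmatrix} 1 & j \\ 0 & p\end{pmatrix}$, as a complete set of representatives for $\Gamma_0(N) \backslash T(p)$. Moreover, fix \[ G_\infty(N) \coloneqq \left\{ \begin{pmatrix} * & * \\ cN & d \end{pmatrix} \in \Gamma_0(N) : (cN, d) = 1 \right\} \] as a complete set of representatives for $\Gamma_0(N)_\infty \backslash \Gamma_0(N)$. Then the map $H_p(N) \times G_\infty(N) \to \Gamma_0(N)_\infty \backslash T(p)$ defined by $(\alpha, \gamma) \mapsto \Gamma_0(N)_\infty \alpha \gamma$ is bijective.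
   Context: $\Gamma_0(N)$ is the usual congruence subgroup of $\mathrm{SL}_2(\mathbb{Z})$ of matrices with lower-left entry divisible by $N$. $\Gamma_0(N)_\infty$ denotes the stabilizer of the cusp $i\infty$ in $\Gamma_0(N)$, i.e. $\Gamma_0(N)_\infty = \{\pm T^n : n \in \mathbb{Z}\}$ with $T = \begin{pmatrix} 1 & 1 \\ 0 & 1\end{pmatrix}$. In the definition of $G_\infty(N)$, $cN$ denotes the product of an integer $c$ and $N$ (the lower-left entry), and $d$ the lower-right entry. -}

module Defs where

open import Data.Nat using (ℕ)
open import Data.Integer using (ℤ; +_; _+_; _*_; -_; _-_)
open import Data.Integer.Divisibility using (_∣_)
open import Data.Fin using (Fin; toℕ)
open import Data.Unit using (⊤)
open import Data.Sum using (_⊎_; inj₁; inj₂)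
open import Data.Product using (Σ; _×_; ∃)
open import Relation.Binary.PropositionalEquality using (_≡_)

record Mat : Set where
  constructor mat
  field
    a b c d : ℤ
open Mat public

infixl 7 _⊙_
_⊙_ : Mat → Mat → Mat
mat a₁ b₁ c₁ d₁ ⊙ mat a₂ b₂ c₂ d₂ =
  mat (a₁ * a₂ + b₁ * c₂) (a₁ * b₂ + b₁ * d₂)
      (c₁ * a₂ + d₁ * c₂) (c₁ * b₂ + d₁ * d₂)

det : Mat → ℤ
det (mat a b c d) = a * d - b * c

Γ₀ : ℕ → Mat → Set
Γ₀ N M = det M ≡ + 1 × (+ N) ∣ c M

Γ∞ : Mat → Set
Γ∞ M = Σ ℤ λ n → (M ≡ mat (+ 1) n (+ 0) (+ 1)) ⊎ (M ≡ mat (- + 1) (- n) (+ 0) (- + 1))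

_∼∞_ : Mat → Mat → Set
X ∼∞ Y = Σ Mat λ S → Γ∞ S × X ≡ S ⊙ Y

InT : ℕ → ℕ → Mat → Set
InT N p M = Σ Mat λ γ₁ → Σ Mat λ γ₂ →
  Γ₀ N γ₁ × Γ₀ N γ₂ × M ≡ γ₁ ⊙ mat (+ 1) (+ 0) (+ 0) (+ p) ⊙ γ₂

HIndex : ℕ → Set
HIndex p = ⊤ ⊎ Fin p

β : (p : ℕ) → HIndex p → Mat
β p (inj₁ _) = mat (+ p) (+ 0) (+ 0) (+ 1)
β p (inj₂ j) = mat (+ 1) (+ toℕ j) (+ 0) (+ p)

IsRepSystem : ℕ → (Mat → Set) → Set
IsRepSystem N G =
  (∀ g → G g → Γ₀ N g) ×
  (∀ γ → Γ₀ N γ → Σ Mat λ g → G g × γ ∼∞ g) ×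
  (∀ g g' → G g → G g' → g ∼∞ g' → g ≡ g')

MapBijective : ℕ → ℕ → (Mat → Set) → Set
MapBijective N p G =
  (∀ (α : HIndex p) g → G g → InT N p (β p α ⊙ g)) ×
  (∀ (α α' : HIndex p) g g' → G g → G g' →
     (β p α ⊙ g) ∼∞ (β p α' ⊙ g') → α ≡ α' × g ≡ g') ×
  (∀ M → InT N p M → Σ (HIndex p) λ α → Σ Mat λ g → G g × M ∼∞ (β p α ⊙ g))

-- Elements of Γ₀(N)_∞ are the upper triangular matrices with diagonal ε = ±1, so they move past
-- the β's explicitly: β_∞ S = S′ β_∞, and β_j S = S′ β_r with r the residue of ε m + j mod p.
-- Surjectivity: write M = γ₁ δ γ₂ with δ = diag(1, p) and c the lower-left entry of γ₁. If p ∣ c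
-- then γ₁ δ = δ g = β₀ g with g ∈ Γ₀(N) (p ∤ N gives N ∣ c/p); otherwise s p + t c = 1 and
-- γ₁ δ = T^{at} β_∞ g with g = (as, b − atd; c, dp) ∈ Γ₀(N). Hence M ∈ Γ∞ β_α Γ₀(N) = Γ∞ β_α Γ∞ G,
-- which lies in Γ∞ β_α′ G. Injectivity: if β_α g ∈ Γ∞ β_α′ g′, then h = g g′⁻¹ satisfies
-- β_α h = S β_α′, and comparing entries (p is not a unit) forces h ∈ Γ∞; so g = g′ because G is a
-- system of representatives, and then β_α ∈ Γ∞ β_α′ gives α = α′. The image lies in T(p) since
-- β_j = δ T^j and, from s p + t N = 1, β_∞ = (ps, −t; N, 1) δ (p, t; −N, s).

module Submission where

open import Defs
open import Data.Nat using (ℕ; _≥_)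
open import Data.Nat.Divisibility using (_∣_)
open import Data.Nat.Primality using (Prime)
open import Relation.Nullary using (¬_)

import Data.Nat as ℕ
import Data.Nat.Properties as ℕ
import Data.Nat.Divisibility as ℕ
open import Data.Nat.Base using (NonTrivial; nonTrivial⇒nonZero; nonTrivial⇒n>1; nonTrivial⇒≢1)
open import Data.Nat.DivMod using (_%_; m<n⇒m%n≡m; [m+kn]%n≡m%n)
open import Data.Nat.Primality using (prime⇒irreducible; prime⇒nonTrivial)
open import Data.Nat.Coprimality as Coprime using (Coprime; coprime-Bézout; coprime-divisor)
open import Data.Nat.GCD using (module Bézout)
open import Data.Integer using (ℤ; +_; -[1+_]; _+_; _*_; -_; _-_; ∣_∣)
open import Data.Integer.Properties using (pos-+; pos-*; neg-involutive; +-identityʳ; *-identityˡ; abs-*; ∣-i∣≡∣i∣; +-injective; *-cancelˡ-≡; *-zeroʳ)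
import Data.Integer.Divisibility.Signed as Signed
open import Data.Integer.DivMod using (_/ℕ_; n%ℕd<d; a≡a%ℕn+[a/ℕn]*n)
open import Data.Integer.Tactic.RingSolver using (solve)
open import Data.Fin using (Fin; toℕ; fromℕ<)
open import Data.Fin.Properties using (toℕ<n; toℕ-injective; toℕ-fromℕ<)
open import Data.List using (_∷_; [])
open import Data.Unit using (tt)
open import Data.Sum using (_⊎_; inj₁; inj₂)
open import Data.Product using (Σ; _×_; _,_; proj₁)
open import Data.Empty using (⊥-elim)
open import Relation.Nullary using (yes; no)
open import Relation.Binary.Bundles using (Preorder)
open import Relation.Binary.PropositionalEquality
  using (_≡_; _≢_; refl; sym; trans; cong; cong₂; subst; isEquivalence; module ≡-Reasoning)
import Relation.Binary.Reasoning.Preorder as PreorderReasoning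

mat-cong : ∀ {a b c d a′ b′ c′ d′} → a ≡ a′ → b ≡ b′ → c ≡ c′ → d ≡ d′ →
           mat a b c d ≡ mat a′ b′ c′ d′
mat-cong refl refl refl refl = refl

-- Pattern synonyms rather than functions, so that the ring solver sees the matrix entries.
pattern Δ x y   = mat x (+ 0) (+ 0) y
pattern T m     = mat (+ 1) m (+ 0) (+ 1)
pattern I       = T (+ 0)
pattern βⱼ J P  = mat (+ 1) J (+ 0) P

⊙-assoc : ∀ X Y Z → X ⊙ Y ⊙ Z ≡ X ⊙ (Y ⊙ Z)
⊙-assoc (mat a₁ b₁ c₁ d₁) (mat a₂ b₂ c₂ d₂) (mat a₃ b₃ c₃ d₃) =
  mat-cong (row a₁ b₁ a₃ c₃) (row a₁ b₁ b₃ d₃) (row c₁ d₁ a₃ c₃) (row c₁ d₁ b₃ d₃)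
  where
  row : ∀ x y z w → (x * a₂ + y * c₂) * z + (x * b₂ + y * d₂) * w ≡
                    x * (a₂ * z + b₂ * w) + y * (c₂ * z + d₂ * w)
  row x y z w = solve (x ∷ y ∷ z ∷ w ∷ a₂ ∷ b₂ ∷ c₂ ∷ d₂ ∷ [])

det-⊙ : ∀ X Y → det (X ⊙ Y) ≡ det X * det Y
det-⊙ (mat a₁ b₁ c₁ d₁) (mat a₂ b₂ c₂ d₂) = expand a₁ b₁ c₁ d₁
  where
  expand : ∀ a b c d → (a * a₂ + b * c₂) * (c * b₂ + d * d₂) - (a * b₂ + b * d₂) * (c * a₂ + d * c₂) ≡
                       (a * d - b * c) * (a₂ * d₂ - b₂ * c₂)
  expand a b c d = solve (a ∷ b ∷ c ∷ d ∷ a₂ ∷ b₂ ∷ c₂ ∷ d₂ ∷ [])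

⊙-identityˡ : ∀ X → I ⊙ X ≡ X
⊙-identityˡ (mat a b c d) = mat-cong (entry a c) (entry b d) (entry′ c a) (entry′ d b)
  where
  entry : ∀ x y → + 1 * x + + 0 * y ≡ x
  entry x y = solve (x ∷ y ∷ [])
  entry′ : ∀ x y → + 0 * y + + 1 * x ≡ x
  entry′ x y = solve (x ∷ y ∷ [])

⊙-identityʳ : ∀ X → X ⊙ I ≡ X
⊙-identityʳ (mat a b c d) = mat-cong (entry a b) (entry′ b a) (entry c d) (entry′ d c)
  where
  entry : ∀ x y → x * + 1 + y * + 0 ≡ x
  entry x y = solve (x ∷ y ∷ [])
  entry′ : ∀ x y → y * + 0 + x * + 1 ≡ x
  entry′ x y = solve (x ∷ y ∷ [])

adj : Mat → Mat
adj (mat a b c d) = mat d (- b) (- c) a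

⊙-adj : ∀ X → X ⊙ adj X ≡ Δ (det X) (det X)
⊙-adj (mat a b c d) = mat-cong (diag₁ a b c d) (off a b) (off′ c d) (diag₂ a b c d)
  where
  diag₁ : ∀ a b c d → a * d + b * - c ≡ a * d - b * c
  diag₁ a b c d = solve (a ∷ b ∷ c ∷ d ∷ [])
  diag₂ : ∀ a b c d → c * - b + d * a ≡ a * d - b * c
  diag₂ a b c d = solve (a ∷ b ∷ c ∷ d ∷ [])
  off : ∀ x y → x * - y + y * x ≡ + 0
  off x y = solve (x ∷ y ∷ [])
  off′ : ∀ x y → x * y + y * - x ≡ + 0
  off′ x y = solve (x ∷ y ∷ [])

adj-⊙ : ∀ X → adj X ⊙ X ≡ Δ (det X) (det X)
adj-⊙ (mat a b c d) = mat-cong (diag₁ a b c d) (off d b) (off′ a c) (diag₂ a b c d)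
  where
  diag₁ : ∀ a b c d → d * a + - b * c ≡ a * d - b * c
  diag₁ a b c d = solve (a ∷ b ∷ c ∷ d ∷ [])
  diag₂ : ∀ a b c d → - c * b + a * d ≡ a * d - b * c
  diag₂ a b c d = solve (a ∷ b ∷ c ∷ d ∷ [])
  off : ∀ x y → x * y + - y * x ≡ + 0
  off x y = solve (x ∷ y ∷ [])
  off′ : ∀ x y → - y * x + x * y ≡ + 0
  off′ x y = solve (x ∷ y ∷ [])

⊙-inverseʳ : ∀ X → det X ≡ + 1 → X ⊙ adj X ≡ I
⊙-inverseʳ X det≡1 = trans (⊙-adj X) (cong (λ δ → Δ δ δ) det≡1)

⊙-inverseˡ : ∀ X → det X ≡ + 1 → adj X ⊙ X ≡ I
⊙-inverseˡ X det≡1 = trans (adj-⊙ X) (cong (λ δ → Δ δ δ) det≡1)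

x⊙z⊙adj[z]≡x : ∀ {Z} → det Z ≡ + 1 → ∀ X → X ⊙ Z ⊙ adj Z ≡ X
x⊙z⊙adj[z]≡x {Z} det≡1 X = begin
  X ⊙ Z ⊙ adj Z    ≡⟨ ⊙-assoc X Z (adj Z) ⟩
  X ⊙ (Z ⊙ adj Z)  ≡⟨ cong (X ⊙_) (⊙-inverseʳ Z det≡1) ⟩
  X ⊙ I            ≡⟨ ⊙-identityʳ X ⟩
  X                ∎
  where open ≡-Reasoning

x⊙adj[z]⊙z≡x : ∀ {Z} → det Z ≡ + 1 → ∀ X → X ⊙ adj Z ⊙ Z ≡ X
x⊙adj[z]⊙z≡x {Z} det≡1 X = begin
  X ⊙ adj Z ⊙ Z    ≡⟨ ⊙-assoc X (adj Z) Z ⟩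
  X ⊙ (adj Z ⊙ Z)  ≡⟨ cong (X ⊙_) (⊙-inverseˡ Z det≡1) ⟩
  X ⊙ I            ≡⟨ ⊙-identityʳ X ⟩
  X                ∎
  where open ≡-Reasoning

Γ₀-⊙ : ∀ {N} X Y → Γ₀ N X → Γ₀ N Y → Γ₀ N (X ⊙ Y)
Γ₀-⊙ {N} X Y (det[X]≡1 , N∣c[X]) (det[Y]≡1 , N∣c[Y]) =
  trans (det-⊙ X Y) (cong₂ _*_ det[X]≡1 det[Y]≡1) ,
  Signed.∣⇒∣ᵤ (Signed.∣m∣n⇒∣m+n (Signed.∣m⇒∣m*n (a Y) (Signed.∣ᵤ⇒∣ {+ N} {c X} N∣c[X]))
                                (Signed.∣n⇒∣m*n (d X) (Signed.∣ᵤ⇒∣ {+ N} {c Y} N∣c[Y])))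

Γ₀-T : ∀ {N} m → Γ₀ N (T m)
Γ₀-T {N} m = det≡1 m , N ℕ.∣0
  where
  det≡1 : ∀ m → + 1 * + 1 - m * + 0 ≡ + 1
  det≡1 m = solve (m ∷ [])

Unit : ℤ → Set
Unit ε = ε ≡ + 1 ⊎ ε ≡ - + 1

unit-* : ∀ {ε ε′} → Unit ε → Unit ε′ → Unit (ε * ε′)
unit-* (inj₁ refl) (inj₁ refl) = inj₁ refl
unit-* (inj₁ refl) (inj₂ refl) = inj₂ refl
unit-* (inj₂ refl) (inj₁ refl) = inj₂ refl
unit-* (inj₂ refl) (inj₂ refl) = inj₁ refl

unit*unit≡1 : ∀ {ε} → Unit ε → ε * ε ≡ + 1
unit*unit≡1 (inj₁ refl) = refl
unit*unit≡1 (inj₂ refl) = refl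

∣unit∣≡1 : ∀ {ε} → Unit ε → ∣ ε ∣ ≡ 1
∣unit∣≡1 (inj₁ refl) = refl
∣unit∣≡1 (inj₂ refl) = refl

data Γ∞-View : Mat → Set where
  upper : ∀ {ε} → Unit ε → ∀ m → Γ∞-View (mat ε m (+ 0) ε)

Γ∞-view : ∀ {S} → Γ∞ S → Γ∞-View S
Γ∞-view (n , inj₁ refl) = upper (inj₁ refl) n
Γ∞-view (n , inj₂ refl) = upper (inj₂ refl) (- n)

±T∈Γ∞ : ∀ {ε} → Unit ε → ∀ m → Γ∞ (mat ε m (+ 0) ε)
±T∈Γ∞ (inj₁ refl) m = m , inj₁ refl
±T∈Γ∞ (inj₂ refl) m = - m , inj₂ (cong (λ b → mat (- + 1) b (+ 0) (- + 1)) (sym (neg-involutive m)))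

Γ∞-⊙ : ∀ {S S′} → Γ∞ S → Γ∞ S′ → Γ∞ (S ⊙ S′)
Γ∞-⊙ S∈Γ∞ S′∈Γ∞ with Γ∞-view S∈Γ∞ | Γ∞-view S′∈Γ∞
... | upper {ε} u m | upper {ε′} u′ m′ =
  subst Γ∞ (sym (product ε ε′ m m′)) (±T∈Γ∞ (unit-* u u′) (ε * m′ + m * ε′))
  where
  product : ∀ ε ε′ m m′ →
            mat ε m (+ 0) ε ⊙ mat ε′ m′ (+ 0) ε′ ≡ mat (ε * ε′) (ε * m′ + m * ε′) (+ 0) (ε * ε′)
  product ε ε′ m m′ = mat-cong (solve (ε ∷ ε′ ∷ m ∷ [])) (solve (ε ∷ ε′ ∷ m ∷ m′ ∷ []))
                               (solve (ε ∷ ε′ ∷ [])) (solve (ε ∷ ε′ ∷ m′ ∷ []))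

∼∞-reflexive : ∀ {X Y} → X ≡ Y → X ∼∞ Y
∼∞-reflexive {Y = Y} refl = I , (+ 0 , inj₁ refl) , sym (⊙-identityˡ Y)

∼∞-trans : ∀ {X Y Z} → X ∼∞ Y → Y ∼∞ Z → X ∼∞ Z
∼∞-trans {Z = Z} (S , S∈Γ∞ , X≡SY) (S′ , S′∈Γ∞ , Y≡S′Z) =
  S ⊙ S′ , Γ∞-⊙ S∈Γ∞ S′∈Γ∞ , trans X≡SY (trans (cong (S ⊙_) Y≡S′Z) (sym (⊙-assoc S S′ Z)))

∼∞-⊙ʳ : ∀ {X Y} Z → X ∼∞ Y → (X ⊙ Z) ∼∞ (Y ⊙ Z)
∼∞-⊙ʳ {Y = Y} Z (S , S∈Γ∞ , X≡SY) = S , S∈Γ∞ , trans (cong (_⊙ Z) X≡SY) (⊙-assoc S Y Z)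

∼∞-preorder : Preorder _ _ _
∼∞-preorder = record
  { Carrier    = Mat
  ; _≈_        = _≡_
  ; _≲_        = _∼∞_
  ; isPreorder = record
    { isEquivalence = isEquivalence
    ; reflexive     = ∼∞-reflexive
    ; trans         = ∼∞-trans
    }
  }

pos-+-* : ∀ a b c → + (a ℕ.+ b ℕ.* c) ≡ + a + + b * + c
pos-+-* a b c = trans (pos-+ a (b ℕ.* c)) (cong (λ x → + a + x) (pos-* b c))

bézout : ∀ {m n} → Coprime m n → Σ ℤ λ s → Σ ℤ λ t → s * + m + t * + n ≡ + 1
bézout {m} {n} m⊥n = fromIdentity (coprime-Bézout m⊥n)
  where
  lift : ∀ a b c d → 1 ℕ.+ a ℕ.* b ≡ c ℕ.* d → + 1 + + a * + b ≡ + c * + d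
  lift a b c d eq = trans (sym (pos-+-* 1 a b)) (trans (cong +_ eq) (pos-* c d))
  cancelˡ : ∀ {u} (v w : ℤ) → + 1 + v * w ≡ u → u + - v * w ≡ + 1
  cancelˡ v w refl = solve (v ∷ w ∷ [])
  cancelʳ : ∀ {u} (v w : ℤ) → + 1 + v * w ≡ u → - v * w + u ≡ + 1
  cancelʳ v w refl = solve (v ∷ w ∷ [])
  fromIdentity : Bézout.Identity 1 m n → Σ ℤ λ s → Σ ℤ λ t → s * + m + t * + n ≡ + 1
  fromIdentity (Bézout.+- x y 1+yn≡xm) = + x , - + y , cancelˡ (+ y) (+ n) (lift y n x m 1+yn≡xm)
  fromIdentity (Bézout.-+ x y 1+xm≡yn) = - + x , + y , cancelʳ (+ x) (+ m) (lift x m y n 1+xm≡yn)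

bézout-ℤ : ∀ {m} c → Coprime m ∣ c ∣ → Σ ℤ λ s → Σ ℤ λ t → s * + m + t * c ≡ + 1
bézout-ℤ (+ n) m⊥n = bézout m⊥n
bézout-ℤ {m} -[1+ n ] m⊥n with bézout m⊥n
... | s , t , eq = s , - t , trans (negate s t (+ m) (+ ℕ.suc n)) eq
  where
  negate : ∀ s t m n → s * m + - t * - n ≡ s * m + t * n
  negate s t m n = solve (s ∷ t ∷ m ∷ n ∷ [])

prime∤⇒coprime : ∀ {p n} → Prime p → ¬ p ∣ n → Coprime p n
prime∤⇒coprime p-prime p∤n (d∣p , d∣n) with prime⇒irreducible p-prime d∣p
... | inj₁ d≡1  = d≡1
... | inj₂ refl = ⊥-elim (p∤n d∣n)

residue-unique : ∀ {j k n p} .{{_ : ℕ.NonZero p}} → j ℕ.< p → k ℕ.< p → j ≡ k ℕ.+ n ℕ.* p → j ≡ k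
residue-unique {j} {k} {n} {p} j<p k<p j≡k+np = begin
  j                   ≡⟨ m<n⇒m%n≡m j<p ⟨
  j % p               ≡⟨ cong (_% p) j≡k+np ⟩
  (k ℕ.+ n ℕ.* p) % p ≡⟨ [m+kn]%n≡m%n k n p ⟩
  k % p               ≡⟨ m<n⇒m%n≡m k<p ⟩
  k                   ∎
  where open ≡-Reasoning

fin-≡-mod : ∀ {p} .{{_ : ℕ.NonZero p}} (j k : Fin p) m → + toℕ j ≡ + toℕ k + m * + p → j ≡ k
fin-≡-mod {p} j k (+ n) eq =
  toℕ-injective (residue-unique {n = n} (toℕ<n j) (toℕ<n k) (+-injective (trans eq (sym (pos-+-* (toℕ k) n p)))))
fin-≡-mod {p} j k -[1+ n ] eq =
  sym (toℕ-injective (residue-unique {n = ℕ.suc n} (toℕ<n k) (toℕ<n j) (+-injective (trans (swap {m = -[1+ n ]} {+ p} eq) (sym (pos-+-* (toℕ j) (ℕ.suc n) p))))))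
  where
  swap : ∀ {x y m q : ℤ} → x ≡ y + m * q → y ≡ x + - m * q
  swap {y = y} {m} {q} refl = solve (y ∷ m ∷ q ∷ [])

Δ⊙ : ∀ P x y z w → Δ P (+ 1) ⊙ mat x y z w ≡ mat (P * x) (P * y) z w
Δ⊙ P x y z w =
  mat-cong (solve (P ∷ x ∷ z ∷ [])) (solve (P ∷ y ∷ w ∷ [])) (solve (x ∷ z ∷ [])) (solve (y ∷ w ∷ []))

βⱼ⊙ : ∀ P J x y z w → βⱼ J P ⊙ mat x y z w ≡ mat (x + J * z) (y + J * w) (P * z) (P * w)
βⱼ⊙ P J x y z w =
  mat-cong (solve (J ∷ x ∷ z ∷ [])) (solve (J ∷ y ∷ w ∷ [])) (solve (P ∷ x ∷ z ∷ [])) (solve (P ∷ y ∷ w ∷ []))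

±T⊙Δ : ∀ P ε m → mat ε m (+ 0) ε ⊙ Δ P (+ 1) ≡ mat (P * ε) m (+ 0) ε
±T⊙Δ P ε m = mat-cong (solve (P ∷ ε ∷ m ∷ [])) (solve (ε ∷ m ∷ [])) (solve (P ∷ ε ∷ [])) (solve (ε ∷ []))

±T⊙βⱼ : ∀ P J ε m → mat ε m (+ 0) ε ⊙ βⱼ J P ≡ mat ε (ε * J + m * P) (+ 0) (P * ε)
±T⊙βⱼ P J ε m =
  mat-cong (solve (ε ∷ m ∷ [])) (solve (P ∷ J ∷ ε ∷ m ∷ [])) (solve (ε ∷ [])) (solve (P ∷ J ∷ ε ∷ []))

Δ⊙±T≡±T⊙Δ : ∀ P ε m → Δ P (+ 1) ⊙ mat ε m (+ 0) ε ≡ mat ε (P * m) (+ 0) ε ⊙ Δ P (+ 1)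
Δ⊙±T≡±T⊙Δ P ε m =
  mat-cong (solve (P ∷ ε ∷ m ∷ [])) (solve (P ∷ ε ∷ m ∷ [])) (solve (P ∷ ε ∷ [])) (solve (P ∷ ε ∷ m ∷ []))

βⱼ⊙±T≡±T⊙βⱼ : ∀ {ε} → Unit ε → ∀ P J R m q → ε * m + J ≡ R + q * P →
             βⱼ J P ⊙ mat ε m (+ 0) ε ≡ mat ε (ε * q) (+ 0) ε ⊙ βⱼ R P
βⱼ⊙±T≡±T⊙βⱼ {ε} u P J R m q εm+J≡R+qP =
  mat-cong (solve (ε ∷ J ∷ q ∷ [])) b-entry (solve (ε ∷ P ∷ [])) (solve (ε ∷ P ∷ R ∷ m ∷ []))
  where
  open ≡-Reasoning
  b-entry : + 1 * m + J * ε ≡ ε * R + ε * q * P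
  b-entry = begin
    + 1 * m + J * ε    ≡⟨ cong (λ t → t * m + J * ε) (unit*unit≡1 u) ⟨
    ε * ε * m + J * ε  ≡⟨ solve (ε ∷ J ∷ m ∷ []) ⟩
    ε * (ε * m + J)    ≡⟨ cong (ε *_) εm+J≡R+qP ⟩
    ε * (R + q * P)    ≡⟨ solve (ε ∷ P ∷ R ∷ q ∷ []) ⟩
    ε * R + ε * q * P  ∎

Δ⊙T≡βⱼ : ∀ P J → Δ (+ 1) P ⊙ T J ≡ βⱼ J P
Δ⊙T≡βⱼ P J = mat-cong refl (solve (J ∷ [])) (solve (P ∷ [])) (solve (P ∷ J ∷ []))

bézout-factorisation : ∀ P N s t → s * P + t * N ≡ + 1 →
  mat (P * s) (- t) N (+ 1) ⊙ Δ (+ 1) P ⊙ mat P t (- N) s ≡ Δ P (+ 1)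
bézout-factorisation P N s t sP+tN≡1 =
  mat-cong a-entry b-entry c-entry d-entry
  where
  open ≡-Reasoning
  b-entry : (P * s * + 1 + - t * + 0) * t + (P * s * + 0 + - t * P) * s ≡ + 0
  b-entry = solve (P ∷ s ∷ t ∷ [])
  c-entry : (N * + 1 + + 1 * + 0) * P + (N * + 0 + + 1 * P) * - N ≡ + 0
  c-entry = solve (P ∷ N ∷ [])
  a-entry : (P * s * + 1 + - t * + 0) * P + (P * s * + 0 + - t * P) * - N ≡ P
  a-entry = begin
    (P * s * + 1 + - t * + 0) * P + (P * s * + 0 + - t * P) * - N ≡⟨ solve (P ∷ N ∷ s ∷ t ∷ []) ⟩
    P * (s * P + t * N)                                           ≡⟨ cong (P *_) sP+tN≡1 ⟩
    P * + 1                                                       ≡⟨ solve (P ∷ []) ⟩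
    P                                                             ∎
  d-entry : (N * + 1 + + 1 * + 0) * t + (N * + 0 + + 1 * P) * s ≡ + 1
  d-entry = begin
    (N * + 1 + + 1 * + 0) * t + (N * + 0 + + 1 * P) * s ≡⟨ solve (P ∷ N ∷ s ∷ t ∷ []) ⟩
    s * P + t * N                                     ≡⟨ sP+tN≡1 ⟩
    + 1                                               ∎

⊙Δ≡Δ⊙ : ∀ P a b q d →
  mat a b (q * P) d ⊙ Δ (+ 1) P ≡ Δ (+ 1) P ⊙ mat a (b * P) q d
⊙Δ≡Δ⊙ P a b q d =
  mat-cong (solve (a ∷ b ∷ q ∷ [])) (solve (P ∷ a ∷ b ∷ d ∷ [])) (solve (P ∷ a ∷ q ∷ d ∷ [])) (solve (P ∷ b ∷ q ∷ d ∷ []))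

⊙Δ≡T⊙Δ⊙ : ∀ P a b c d s t → s * P + t * c ≡ + 1 →
  mat a b c d ⊙ Δ (+ 1) P ≡
  T (a * t) ⊙ (Δ P (+ 1) ⊙ mat (a * s) (b - a * t * d) c (d * P))
⊙Δ≡T⊙Δ⊙ P a b c d s t sP+tc≡1 =
  mat-cong a-entry b-entry c-entry d-entry
  where
  open ≡-Reasoning
  b-entry : a * + 0 + b * P ≡ + 1 * (P * (b - a * t * d) + + 0 * (d * P)) + a * t * (+ 0 * (b - a * t * d) + + 1 * (d * P))
  b-entry = solve (P ∷ a ∷ b ∷ d ∷ t ∷ [])
  c-entry : c * + 1 + d * + 0 ≡ + 0 * (P * (a * s) + + 0 * c) + + 1 * (+ 0 * (a * s) + + 1 * c)
  c-entry = solve (P ∷ a ∷ c ∷ d ∷ s ∷ [])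
  d-entry : c * + 0 + d * P ≡ + 0 * (P * (b - a * t * d) + + 0 * (d * P)) + + 1 * (+ 0 * (b - a * t * d) + + 1 * (d * P))
  d-entry = solve (P ∷ a ∷ b ∷ c ∷ d ∷ t ∷ [])
  a-entry : a * + 1 + b * + 0 ≡ + 1 * (P * (a * s) + + 0 * c) + a * t * (+ 0 * (a * s) + + 1 * c)
  a-entry = begin
    a * + 1 + b * + 0 ≡⟨ solve (a ∷ b ∷ []) ⟩
    a * + 1           ≡⟨ cong (a *_) sP+tc≡1 ⟨
    a * (s * P + t * c) ≡⟨ solve (P ∷ a ∷ c ∷ s ∷ t ∷ []) ⟩
    + 1 * (P * (a * s) + + 0 * c) + a * t * (+ 0 * (a * s) + + 1 * c) ∎

⊙Δ≡T⊙Δ⊙-det : ∀ P a b c d s t → s * P + t * c ≡ + 1 →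
  det (mat (a * s) (b - a * t * d) c (d * P)) ≡ det (mat a b c d)
⊙Δ≡T⊙Δ⊙-det P a b c d s t sP+tc≡1 = begin
  a * s * (d * P) - (b - a * t * d) * c ≡⟨ solve (P ∷ a ∷ b ∷ c ∷ d ∷ s ∷ t ∷ []) ⟩
  a * d * (s * P + t * c) - b * c       ≡⟨ cong (λ u → a * d * u - b * c) sP+tc≡1 ⟩
  a * d * + 1 - b * c                   ≡⟨ solve (a ∷ b ∷ c ∷ d ∷ []) ⟩
  a * d - b * c                         ∎
  where open ≡-Reasoning

module _ {p : ℕ} .{{_ : NonTrivial p}} where

  private instance
    p≢0 : ℕ.NonZero p
    p≢0 = nonTrivial⇒nonZero p

  p*x≢unit : ∀ {ε} x → Unit ε → + p * x ≢ ε
  p*x≢unit {ε} x u p*x≡ε = nonTrivial⇒≢1 (ℕ.m*n≡1⇒m≡1 p ∣ x ∣ (begin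
    p ℕ.* ∣ x ∣  ≡⟨ abs-* (+ p) x ⟨
    ∣ + p * x ∣  ≡⟨ cong ∣_∣ p*x≡ε ⟩
    ∣ ε ∣        ≡⟨ ∣unit∣≡1 u ⟩
    1            ∎))
    where open ≡-Reasoning

  Γ∞-shape : ∀ {ε x y z w} → Unit ε → x ≡ ε → z ≡ + 0 → w ≡ ε → Γ∞ (mat x y z w)
  Γ∞-shape {y = y} u refl refl refl = ±T∈Γ∞ u y

  β⊙h≡±T⊙β⇒h∈Γ∞ : ∀ {ε} → Unit ε → ∀ m α α′ x y z w →
                   β p α ⊙ mat x y z w ≡ mat ε m (+ 0) ε ⊙ β p α′ → Γ∞ (mat x y z w)
  β⊙h≡±T⊙β⇒h∈Γ∞ {ε} u m (inj₁ _) (inj₁ _) x y z w eq = Γ∞-shape u x≡ε (cong c eq′) (cong d eq′)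
    where
    eq′ : mat (+ p * x) (+ p * y) z w ≡ mat (+ p * ε) m (+ 0) ε
    eq′ = trans (sym (Δ⊙ (+ p) x y z w)) (trans eq (±T⊙Δ (+ p) ε m))
    x≡ε : x ≡ ε
    x≡ε = *-cancelˡ-≡ (+ p) x ε (cong a eq′)
  β⊙h≡±T⊙β⇒h∈Γ∞ {ε} u m (inj₁ _) (inj₂ k) x y z w eq =
    ⊥-elim (p*x≢unit x u (cong a (trans (sym (Δ⊙ (+ p) x y z w)) (trans eq (±T⊙βⱼ (+ p) (+ toℕ k) ε m)))))
  β⊙h≡±T⊙β⇒h∈Γ∞ {ε} u m (inj₂ j) (inj₁ _) x y z w eq =
    ⊥-elim (p*x≢unit w u (cong d (trans (sym (βⱼ⊙ (+ p) (+ toℕ j) x y z w)) (trans eq (±T⊙Δ (+ p) ε m)))))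
  β⊙h≡±T⊙β⇒h∈Γ∞ {ε} u m (inj₂ j) (inj₂ k) x y z w eq = Γ∞-shape u x≡ε z≡0 w≡ε
    where
    J K : ℤ
    J = + toℕ j
    K = + toℕ k
    eq′ : mat (x + J * z) (y + J * w) (+ p * z) (+ p * w) ≡ mat ε (ε * K + m * + p) (+ 0) (+ p * ε)
    eq′ = trans (sym (βⱼ⊙ (+ p) J x y z w)) (trans eq (±T⊙βⱼ (+ p) K ε m))
    z≡0 : z ≡ + 0
    z≡0 = *-cancelˡ-≡ (+ p) z (+ 0) (trans (cong c eq′) (sym (*-zeroʳ (+ p))))
    w≡ε : w ≡ ε
    w≡ε = *-cancelˡ-≡ (+ p) w ε (cong d eq′)
    x≡ε : x ≡ ε
    x≡ε = begin
      x           ≡⟨ trans (cong (λ t → x + t) (*-zeroʳ J)) (+-identityʳ x) ⟨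
      x + J * + 0 ≡⟨ cong (λ t → x + J * t) z≡0 ⟨
      x + J * z   ≡⟨ cong a eq′ ⟩
      ε           ∎
      where open ≡-Reasoning

  β⊙h∼∞β⇒h∈Γ∞ : ∀ α α′ h → (β p α ⊙ h) ∼∞ β p α′ → Γ∞ h
  β⊙h∼∞β⇒h∈Γ∞ α α′ (mat x y z w) (S , S∈Γ∞ , eq) with Γ∞-view S∈Γ∞
  ... | upper u m = β⊙h≡±T⊙β⇒h∈Γ∞ u m α α′ x y z w eq

  β≡±T⊙β⇒≡ : ∀ {ε} → Unit ε → ∀ m α α′ → β p α ≡ mat ε m (+ 0) ε ⊙ β p α′ → α ≡ α′
  β≡±T⊙β⇒≡ u m (inj₁ _) (inj₁ _) _ = refl
  β≡±T⊙β⇒≡ {ε} u m (inj₁ _) (inj₂ k) eq =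
    ⊥-elim (p*x≢unit ε (inj₁ refl) (sym (cong d (trans eq (±T⊙βⱼ (+ p) (+ toℕ k) ε m)))))
  β≡±T⊙β⇒≡ {ε} u m (inj₂ j) (inj₁ _) eq =
    ⊥-elim (p*x≢unit ε (inj₁ refl) (sym (cong a (trans eq (±T⊙Δ (+ p) ε m)))))
  β≡±T⊙β⇒≡ (inj₁ refl) m (inj₂ j) (inj₂ k) eq =
    cong inj₂ (fin-≡-mod j k m (trans (cong b eq) (cong (λ t → t + m * + p) (*-identityˡ (+ toℕ k)))))
  β≡±T⊙β⇒≡ (inj₂ refl) m (inj₂ j) (inj₂ k) eq with cong a (trans eq (±T⊙βⱼ (+ p) (+ toℕ k) (- + 1) m))
  ... | ()

  β-∼∞-injective : ∀ α α′ → β p α ∼∞ β p α′ → α ≡ α′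
  β-∼∞-injective α α′ (S , S∈Γ∞ , eq) with Γ∞-view S∈Γ∞
  ... | upper u m = β≡±T⊙β⇒≡ u m α α′ eq

  β⊙Γ∞∼∞β : ∀ α {S} → Γ∞ S → Σ (HIndex p) λ α′ → (β p α ⊙ S) ∼∞ β p α′
  β⊙Γ∞∼∞β α S∈Γ∞ with Γ∞-view S∈Γ∞
  β⊙Γ∞∼∞β (inj₁ tt) _ | upper {ε} u m =
    inj₁ tt , mat ε (+ p * m) (+ 0) ε , ±T∈Γ∞ u _ , Δ⊙±T≡±T⊙Δ (+ p) ε m
  β⊙Γ∞∼∞β (inj₂ j) _ | upper {ε} u m =
    inj₂ r , mat ε (ε * q) (+ 0) ε , ±T∈Γ∞ u _ , βⱼ⊙±T≡±T⊙βⱼ u (+ p) (+ toℕ j) (+ toℕ r) m q n≡r+qp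
    where
    n : ℤ
    n = ε * m + + toℕ j
    r : Fin p
    r = fromℕ< (n%ℕd<d n p)
    q : ℤ
    q = n /ℕ p
    n≡r+qp : n ≡ + toℕ r + q * + p
    n≡r+qp = trans (a≡a%ℕn+[a/ℕn]*n n p) (cong (λ t → + t + q * + p) (sym (toℕ-fromℕ< (n%ℕd<d n p))))

  β⊙-injective : ∀ {N G} → IsRepSystem N G → ∀ α α′ g g′ → G g → G g′ →
                 (β p α ⊙ g) ∼∞ (β p α′ ⊙ g′) → α ≡ α′ × g ≡ g′
  β⊙-injective (G⊆Γ₀ , _ , G-unique) α α′ g g′ g∈G g′∈G (S , S∈Γ∞ , eq) =
    β-∼∞-injective α α′ (S , S∈Γ∞ , βα≡Sβα′) , g≡g′
    where
    open ≡-Reasoning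
    det[g′]≡1 : det g′ ≡ + 1
    det[g′]≡1 = proj₁ (G⊆Γ₀ g′ g′∈G)
    h : Mat
    h = g ⊙ adj g′
    βh≡Sβ : β p α ⊙ h ≡ S ⊙ β p α′
    βh≡Sβ = begin
      β p α ⊙ (g ⊙ adj g′)      ≡⟨ ⊙-assoc (β p α) g (adj g′) ⟨
      β p α ⊙ g ⊙ adj g′        ≡⟨ cong (_⊙ adj g′) (trans eq (sym (⊙-assoc S (β p α′) g′))) ⟩
      S ⊙ β p α′ ⊙ g′ ⊙ adj g′  ≡⟨ x⊙z⊙adj[z]≡x det[g′]≡1 (S ⊙ β p α′) ⟩
      S ⊙ β p α′                ∎
    g≡g′ : g ≡ g′
    g≡g′ = G-unique g g′ g∈G g′∈G
      (h , β⊙h∼∞β⇒h∈Γ∞ α α′ h (S , S∈Γ∞ , βh≡Sβ) , sym (x⊙adj[z]⊙z≡x det[g′]≡1 g))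
    βα≡Sβα′ : β p α ≡ S ⊙ β p α′
    βα≡Sβα′ = begin
      β p α      ≡⟨ ⊙-identityʳ (β p α) ⟨
      β p α ⊙ I  ≡⟨ cong (β p α ⊙_) (trans (cong (_⊙ adj g′) g≡g′) (⊙-inverseʳ g′ det[g′]≡1)) ⟨
      β p α ⊙ h  ≡⟨ βh≡Sβ ⟩
      S ⊙ β p α′ ∎

InT-⊙Γ₀ : ∀ {N p M γ} → InT N p M → Γ₀ N γ → InT N p (M ⊙ γ)
InT-⊙Γ₀ {p = p} {γ = γ} (γ₁ , γ₂ , γ₁∈Γ₀ , γ₂∈Γ₀ , M≡γ₁Δγ₂) γ∈Γ₀ =
  γ₁ , γ₂ ⊙ γ , γ₁∈Γ₀ , Γ₀-⊙ γ₂ γ γ₂∈Γ₀ γ∈Γ₀ , trans (cong (_⊙ γ) M≡γ₁Δγ₂) (⊙-assoc (γ₁ ⊙ Δ (+ 1) (+ p)) γ₂ γ)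

β∈T : ∀ {N p} → Coprime p N → ∀ α → InT N p (β p α)
β∈T {N} {p} _ (inj₂ j) =
  I , T (+ toℕ j) , Γ₀-T (+ 0) , Γ₀-T (+ toℕ j) ,
  sym (trans (cong (_⊙ T (+ toℕ j)) (⊙-identityˡ (Δ (+ 1) (+ p)))) (Δ⊙T≡βⱼ (+ p) (+ toℕ j)))
β∈T {N} {p} p⊥N (inj₁ tt) with bézout-ℤ (+ N) p⊥N
... | s , t , sp+tN≡1 =
  mat (+ p * s) (- t) (+ N) (+ 1) , mat (+ p) t (- + N) s ,
  (trans (det₁ (+ p) (+ N) s t) sp+tN≡1 , ℕ.∣-refl) ,
  (trans (det₂ (+ p) (+ N) s t) sp+tN≡1 , subst (N ∣_) (sym (∣-i∣≡∣i∣ (+ N))) ℕ.∣-refl) ,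
  sym (bézout-factorisation (+ p) (+ N) s t sp+tN≡1)
  where
  det₁ : ∀ P N s t → P * s * + 1 - - t * N ≡ s * P + t * N
  det₁ P N s t = solve (P ∷ N ∷ s ∷ t ∷ [])
  det₂ : ∀ P N s t → P * s - t * - N ≡ s * P + t * N
  det₂ P N s t = solve (P ∷ N ∷ s ∷ t ∷ [])

module _ {N p : ℕ} (p-prime : Prime p) (N⊥p : Coprime N p) where

  private instance
    p-nonTrivial : NonTrivial p
    p-nonTrivial = prime⇒nonTrivial p-prime

  j₀ : Fin p
  j₀ = fromℕ< (ℕ.<⇒≤ (nonTrivial⇒n>1 p))

  β[j₀]≡Δ : β p (inj₂ j₀) ≡ Δ (+ 1) (+ p)
  β[j₀]≡Δ = cong (λ j → βⱼ (+ j) (+ p)) (toℕ-fromℕ< (ℕ.<⇒≤ (nonTrivial⇒n>1 p)))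

  _∈Γ∞βΓ₀ : Mat → Set
  M ∈Γ∞βΓ₀ = Σ (HIndex p) λ α → Σ Mat λ g → Γ₀ N g × M ∼∞ (β p α ⊙ g)

  Γ₀⊙Δ∈Γ∞βΓ₀ : ∀ γ → Γ₀ N γ → (γ ⊙ Δ (+ 1) (+ p)) ∈Γ∞βΓ₀
  Γ₀⊙Δ∈Γ∞βΓ₀ (mat a b c d) (det≡1 , N∣c) with + p Signed.∣? c
  ... | yes (Signed.divides q refl) =
    inj₂ j₀ , mat a (b * + p) q d , (trans (det-shift a b q d (+ p)) det≡1 , N∣q) ,
    ∼∞-reflexive (trans (⊙Δ≡Δ⊙ (+ p) a b q d) (cong (_⊙ mat a (b * + p) q d) (sym β[j₀]≡Δ)))
    where
    det-shift : ∀ a b q d P → a * d - b * P * q ≡ a * d - b * (q * P)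
    det-shift a b q d P = solve (a ∷ b ∷ q ∷ d ∷ P ∷ [])
    N∣q : N ∣ ∣ q ∣
    N∣q = coprime-divisor N⊥p (subst (N ∣_) (trans (abs-* q (+ p)) (ℕ.*-comm ∣ q ∣ p)) N∣c)
  ... | no p∤c with bézout-ℤ c (prime∤⇒coprime p-prime (λ p∣c → p∤c (Signed.∣ᵤ⇒∣ {+ p} {c} p∣c)))
  ... | s , t , sp+tc≡1 =
    inj₁ tt , mat (a * s) (b - a * t * d) c (d * + p) , (trans (⊙Δ≡T⊙Δ⊙-det (+ p) a b c d s t sp+tc≡1) det≡1 , N∣c) ,
    T (a * t) , (a * t , inj₁ refl) , ⊙Δ≡T⊙Δ⊙ (+ p) a b c d s t sp+tc≡1

  InT⊆Γ∞βΓ₀ : ∀ {M} → InT N p M → M ∈Γ∞βΓ₀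
  InT⊆Γ∞βΓ₀ {M} (γ₁ , γ₂ , γ₁∈Γ₀ , γ₂∈Γ₀ , M≡γ₁Δγ₂) with Γ₀⊙Δ∈Γ∞βΓ₀ γ₁ γ₁∈Γ₀
  ... | α , g , g∈Γ₀ , γ₁Δ∼βg = α , g ⊙ γ₂ , Γ₀-⊙ g γ₂ g∈Γ₀ γ₂∈Γ₀ , (begin
    M                ≡⟨ M≡γ₁Δγ₂ ⟩
    γ₁ ⊙ Δ (+ 1) (+ p) ⊙ γ₂    ≲⟨ ∼∞-⊙ʳ γ₂ γ₁Δ∼βg ⟩
    β p α ⊙ g ⊙ γ₂   ≡⟨ ⊙-assoc (β p α) g γ₂ ⟩
    β p α ⊙ (g ⊙ γ₂) ∎)
    where open PreorderReasoning ∼∞-preorder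

  β⊙-surjective : ∀ {G} → IsRepSystem N G →
    ∀ M → InT N p M → Σ (HIndex p) λ α → Σ Mat λ g → G g × M ∼∞ (β p α ⊙ g)
  β⊙-surjective (_ , G-covers , _) M M∈T =
    let α , g₀ , g₀∈Γ₀ , M∼βg₀ = InT⊆Γ∞βΓ₀ M∈T
        g , g∈G , S , S∈Γ∞ , g₀≡Sg = G-covers g₀ g₀∈Γ₀
        α′ , βS∼β′ = β⊙Γ∞∼∞β α S∈Γ∞
        open PreorderReasoning ∼∞-preorder
    in α′ , g , g∈G , (begin
      M                ≲⟨ M∼βg₀ ⟩
      β p α ⊙ g₀       ≡⟨ cong (β p α ⊙_) g₀≡Sg ⟩
      β p α ⊙ (S ⊙ g)  ≡⟨ ⊙-assoc (β p α) S g ⟨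
      β p α ⊙ S ⊙ g    ≲⟨ ∼∞-⊙ʳ g βS∼β′ ⟩
      β p α′ ⊙ g       ∎)

lemma4p3 : (N p : ℕ) → N ≥ 1 → Prime p → ¬ (p ∣ N) →
    (G : Mat → Set) → IsRepSystem N G → MapBijective N p G
lemma4p3 N p _ p-prime p∤N G G-rep@(G⊆Γ₀ , _) =
    (λ α g g∈G → InT-⊙Γ₀ (β∈T p⊥N α) (G⊆Γ₀ g g∈G))
  , β⊙-injective {{prime⇒nonTrivial p-prime}} G-rep
  , β⊙-surjective p-prime (Coprime.sym p⊥N) G-rep
  where
  p⊥N : Coprime p N
  p⊥N = prime∤⇒coprime p-prime p∤N
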